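{- Let $r$ be a positive integer and $n>r$. Then the $r$th moment of the type $B_n$ positive Eulerian distribution, and likewise of the type $B_n$ negative Eulerian distribution, equals the $r$th moment of the type $B_n$ Eulerian distribution.
   Context: $B_n$ is the group of bijections $w$ of $\{ -n,\dots,n\}$ with $w(-i)=-w(i)$, $w(0)=0$. $\mathrm{des}_B(w)=|\{0\le i\le n-1:w(i)>w(i+1)\}|$. Writing $w=u^J$ ($u\in S_n$, $J\subseteq[n]$ the set of positions where $w(j)=-u(j)<0$), $\mathrm{sgn}_B(w)=(-1)^{|J|}\mathrm{sgn}(u)$, and $B_n^\pm=\{w:\mathrm{sgn}_B(w)=\pm1\}$. The type $B_n$ Eulerian distribution is the law of $\mathrm{des}_B(w)$ for $w$ uniform in $B_n$; the type $B_n$ positive (resp. negative) Eulerian distribution is the law of $\mathrm{des}_B(w)$ for $w$ uniform in $B_n^+$ (resp. $B_n^-$). -}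

module Defs where

open import Data.Bool using (Bool; true; false; not; _∧_; if_then_else_)
open import Data.Nat as ℕ using (ℕ; zero; suc; _+_; _^_)
open import Data.Integer as ℤ using (ℤ; +_; -[1+_]; ∣_∣; -_)
open import Data.List using (List; []; _∷_; map; concatMap; upTo; _++_; filterᵇ; length)
open import Data.Nat.ListAction using (sum)
open import Data.Rational using (ℚ; _/_; 0ℚ)
open import Relation.Nullary using (does)

-- A signed permutation w ∈ B_n is represented by its window
-- [w(1), …, w(n)] (a list of integers); w(0) = 0 and w(-i) = -w(i)
-- are then determined.

letters : ℕ → List ℤ
letters n = map (λ i → + suc i) (upTo n) ++ map (λ i → -[1+ i ]) (upTo n)

words : ℕ → List ℤ → List (List ℤ)
words zero    A = [] ∷ []
words (suc k) A = concatMap (λ a → map (a ∷_) (words k A)) A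

allᵇ : (ℤ → Bool) → List ℤ → Bool
allᵇ p []       = true
allᵇ p (x ∷ xs) = p x ∧ allᵇ p xs

distinctAbsᵇ : List ℤ → Bool
distinctAbsᵇ []       = true
distinctAbsᵇ (x ∷ xs) = allᵇ (λ y → not (∣ x ∣ ℕ.≡ᵇ ∣ y ∣)) xs ∧ distinctAbsᵇ xs

B : ℕ → List (List ℤ)
B n = filterᵇ distinctAbsᵇ (words n (letters n))

desFrom : ℤ → List ℤ → ℕ
desFrom prev []       = 0
desFrom prev (x ∷ xs) = (if does (x ℤ.<? prev) then 1 else 0) + desFrom x xs

desB : List ℤ → ℕ
desB w = desFrom (+ 0) w

negs : List ℤ → ℕ
negs []       = 0
negs (x ∷ xs) = (if does (x ℤ.<? + 0) then 1 else 0) + negs xs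

-- inversions of u = |w| (u(i) = |w(i)|), so sgn(u) = (-1)^(inv u)
invAbs : List ℤ → ℕ
invAbs []       = 0
invAbs (x ∷ xs) = length (filterᵇ (λ y → does (∣ y ∣ ℕ.<? ∣ x ∣)) xs) + invAbs xs

neg1^ : ℕ → ℤ
neg1^ zero    = + 1
neg1^ (suc k) = - neg1^ k

sgnB : List ℤ → ℤ
sgnB w = neg1^ (negs w) ℤ.* neg1^ (invAbs w)

Bplus : ℕ → List (List ℤ)
Bplus n = filterᵇ (λ w → does (sgnB w ℤ.≟ + 1)) (B n)

Bminus : ℕ → List (List ℤ)
Bminus n = filterᵇ (λ w → does (sgnB w ℤ.≟ -[1+ 0 ])) (B n)

-- average of a list of naturals (uniform distribution on the list);
-- the empty list gets 0 by convention (never used: B_n^± ≠ ∅ for n ≥ 1)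
average : List ℕ → ℚ
average []       = 0ℚ
average (x ∷ xs) = (+ sum (x ∷ xs)) / suc (length xs)

momentDesB : ℕ → List (List ℤ) → ℚ
momentDesB r S = average (map (λ w → desB w ^ r) S)

-- With Δ f x = f x − f (x + 1), the signed descent sum ∑_{w ∈ B_n} sgn_B(w) f(des_B w) equals
-- (Δ^n f)(0).  Build the window letter by letter: once the first letter a is placed, the rest is
-- a signed permutation of the remaining absolute values, whose descents are counted from a and
-- whose sign is twisted by the inversions of a with the smaller values.  Only the two letters ±m
-- of least absolute value m can come first without killing the rest of the sum, and these two
-- differ by one sign and, when the previous letter lies between −m and m, by one descent: that is
-- one application of Δ.  Since Δ^n annihilates polynomials of degree < n, for r < n the signed
-- sum of des_B^r vanishes (for r = 0 this says |B_n^+| = |B_n^-|), so B_n^+ and B_n^- each carry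
-- exactly half of the total and of the count, and the r-th moments agree.

module Submission where

open import Defs
open import Data.Nat using (ℕ; _≤_; _<_)
open import Data.Product using (_×_)
open import Relation.Binary.PropositionalEquality using (_≡_)

open import Data.Bool using (Bool; true; false; not; _∧_; if_then_else_; T)
open import Data.Bool.Properties using (T-not-≡)
open import Data.Empty using (⊥-elim)
open import Data.Integer as ℤ using (ℤ; +_; -[1+_]; ∣_∣; 0ℤ; 1ℤ; -1ℤ; _+_; _*_; _-_; -_)
import Data.Integer.Properties as ℤ
open import Data.Integer.Tactic.RingSolver using (solve-∀)
open import Data.List using (List; []; _∷_; map; concatMap; upTo; _++_; filterᵇ; length)
import Data.List.Properties as List
open import Data.List.Membership.Propositional using (_∈_)
open import Data.List.Relation.Unary.All as All using (All; []; _∷_)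
open import Data.List.Relation.Unary.AllPairs as AllPairs using (AllPairs; []; _∷_)
import Data.List.Relation.Unary.AllPairs.Properties as AllPairs
open import Data.List.Relation.Unary.Any using (here; there)
open import Data.Nat as ℕ using (zero; suc; _≤′_)
import Data.Nat.Properties as ℕ
open import Data.Nat.ListAction using (sum)
import Data.Nat.Tactic.RingSolver as ℕ-Solver
open import Data.Product using (_,_; proj₁; proj₂)
open import Data.Rational.Unnormalised using (mkℚᵘ; *≡*)
import Data.Rational.Properties as ℚ
open import Data.Sum using (_⊎_; inj₁; inj₂)
open import Data.Unit using (tt)
open import Function using (_∘_)
open import Function.Bundles using (Equivalence)
open import Relation.Binary.PropositionalEquality
  using (_≢_; refl; sym; trans; cong; cong₂; subst; _≗_; module ≡-Reasoning)
open import Relation.Nullary using (does; yes; no)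
open import Relation.Nullary.Decidable using (T?; dec-true; dec-false)

∑ : {A : Set} → List A → (A → ℤ) → ℤ
∑ []       h = 0ℤ
∑ (x ∷ xs) h = h x + ∑ xs h

module _ {A : Set} where

  ∑-cong : (xs : List A) {h h′ : A → ℤ} → h ≗ h′ → ∑ xs h ≡ ∑ xs h′
  ∑-cong []       e = refl
  ∑-cong (x ∷ xs) e = cong₂ _+_ (e x) (∑-cong xs e)

  ∑-zero : (xs : List A) {h : A → ℤ} → (∀ {x} → x ∈ xs → h x ≡ 0ℤ) → ∑ xs h ≡ 0ℤ
  ∑-zero []       e = refl
  ∑-zero (x ∷ xs) e = cong₂ _+_ (e (here refl)) (∑-zero xs (e ∘ there))

  ∑-++ : (xs ys : List A) (h : A → ℤ) → ∑ (xs ++ ys) h ≡ ∑ xs h + ∑ ys h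
  ∑-++ []       ys h = sym (ℤ.+-identityˡ _)
  ∑-++ (x ∷ xs) ys h = trans (cong (_+_ (h x)) (∑-++ xs ys h)) (sym (ℤ.+-assoc (h x) _ _))

  ∑-+ : (xs : List A) (g h : A → ℤ) → ∑ xs (λ x → g x + h x) ≡ ∑ xs g + ∑ xs h
  ∑-+ []       g h = refl
  ∑-+ (x ∷ xs) g h = trans (cong (_+_ (g x + h x)) (∑-+ xs g h)) (shuffle (g x) (h x) _ _)
    where
    shuffle : ∀ a b c d → (a + b) + (c + d) ≡ (a + c) + (b + d)
    shuffle = solve-∀

  ∑-*ˡ : (xs : List A) (c : ℤ) (h : A → ℤ) → ∑ xs (λ x → c * h x) ≡ c * ∑ xs h
  ∑-*ˡ []       c h = sym (ℤ.*-zeroʳ c)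
  ∑-*ˡ (x ∷ xs) c h = trans (cong (_+_ (c * h x)) (∑-*ˡ xs c h)) (sym (ℤ.*-distribˡ-+ c (h x) _))

  ∑-filterᵇ : (p : A → Bool) (xs : List A) (h : A → ℤ) →
    ∑ (filterᵇ p xs) h ≡ ∑ xs (λ x → if p x then h x else 0ℤ)
  ∑-filterᵇ p []       h = refl
  ∑-filterᵇ p (x ∷ xs) h with p x
  ... | true  = cong (_+_ (h x)) (∑-filterᵇ p xs h)
  ... | false = trans (∑-filterᵇ p xs h) (sym (ℤ.+-identityˡ _))

  ∑-map : {B : Set} (g : B → A) (xs : List B) (h : A → ℤ) → ∑ (map g xs) h ≡ ∑ xs (h ∘ g)
  ∑-map g []       h = refl
  ∑-map g (x ∷ xs) h = cong (_+_ (h (g x))) (∑-map g xs h)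

  ∑-concatMap : {B : Set} (g : B → List A) (xs : List B) (h : A → ℤ) →
    ∑ (concatMap g xs) h ≡ ∑ xs (λ x → ∑ (g x) h)
  ∑-concatMap g []       h = refl
  ∑-concatMap g (x ∷ xs) h = trans (∑-++ (g x) _ h) (cong (_+_ (∑ (g x) h)) (∑-concatMap g xs h))

∑-words-suc : ∀ k (A : List ℤ) (h : List ℤ → ℤ) →
  ∑ (words (suc k) A) h ≡ ∑ A (λ a → ∑ (words k A) (h ∘ (a ∷_)))
∑-words-suc k A h = trans (∑-concatMap (λ a → map (a ∷_) (words k A)) A h)
  (∑-cong A (λ a → ∑-map (a ∷_) (words k A) h))

∑-words-allᵇ : ∀ k (A : List ℤ) (p : ℤ → Bool) (h : List ℤ → ℤ) →
  ∑ (words k A) (λ ws → if allᵇ p ws then h ws else 0ℤ) ≡ ∑ (words k (filterᵇ p A)) h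
∑-words-allᵇ zero    A p h = refl
∑-words-allᵇ (suc k) A p h = begin
    ∑ (words (suc k) A) (λ ws → if allᵇ p ws then h ws else 0ℤ)
  ≡⟨ ∑-words-suc k A _ ⟩
    ∑ A (λ a → ∑ (words k A) (λ ws → if p a ∧ allᵇ p ws then h (a ∷ ws) else 0ℤ))
  ≡⟨ ∑-cong A first ⟩
    ∑ A (λ a → if p a then ∑ (words k (filterᵇ p A)) (h ∘ (a ∷_)) else 0ℤ)
  ≡⟨ ∑-filterᵇ p A _ ⟨
    ∑ (filterᵇ p A) (λ a → ∑ (words k (filterᵇ p A)) (h ∘ (a ∷_)))
  ≡⟨ ∑-words-suc k (filterᵇ p A) h ⟨
    ∑ (words (suc k) (filterᵇ p A)) h ∎
  where
  open ≡-Reasoning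
  first : ∀ a → ∑ (words k A) (λ ws → if p a ∧ allᵇ p ws then h (a ∷ ws) else 0ℤ)
              ≡ (if p a then ∑ (words k (filterᵇ p A)) (h ∘ (a ∷_)) else 0ℤ)
  first a with p a
  ... | true  = ∑-words-allᵇ k A p (h ∘ (a ∷_))
  ... | false = ∑-zero (words k A) (λ _ → refl)

-- The negative of the usual forward difference, so that Δ^ k f 0 = ∑ᵢ (−1)^i (k choose i) f i.
Δ : (ℕ → ℤ) → ℕ → ℤ
Δ f x = f x - f (suc x)

Δ^ : ℕ → (ℕ → ℤ) → ℕ → ℤ
Δ^ zero    f = f
Δ^ (suc k) f = Δ (Δ^ k f)

Δ^-cong : ∀ k {f g : ℕ → ℤ} → f ≗ g → Δ^ k f ≗ Δ^ k g
Δ^-cong zero    e x = e x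
Δ^-cong (suc k) e x = cong₂ _-_ (Δ^-cong k e x) (Δ^-cong k e (suc x))

Δ^-shift : ∀ k (f : ℕ → ℤ) x → Δ^ k (f ∘ suc) x ≡ Δ^ k f (suc x)
Δ^-shift zero    f x = refl
Δ^-shift (suc k) f x = cong₂ _-_ (Δ^-shift k f x) (Δ^-shift k f (suc x))

Δ^-leibniz : ∀ k (g : ℕ → ℤ) x →
  Δ^ (suc k) (λ y → + y * g y) x ≡ + x * Δ^ (suc k) g x - + suc k * Δ^ k g (suc x)
Δ^-leibniz zero    g x = step (+ x) (g x) (g (suc x))
  where
  step : ∀ X A B → X * A - (1ℤ + X) * B ≡ X * (A - B) - 1ℤ * B
  step = solve-∀
Δ^-leibniz (suc k) g x rewrite Δ^-leibniz k g x | Δ^-leibniz k g (suc x) =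
  step (+ x) (+ k) (Δ^ (suc k) g x) (Δ^ k g (suc x)) (Δ^ k g (suc (suc x)))
  where
  step : ∀ X K A B C → (X * A - (1ℤ + K) * B) - ((1ℤ + X) * (B - C) - (1ℤ + K) * C)
                      ≡ X * (A - (B - C)) - (1ℤ + (1ℤ + K)) * (B - C)
  step = solve-∀

Δ^-zero-suc : ∀ k f → Δ^ k f ≗ (λ _ → 0ℤ) → Δ^ (suc k) f ≗ (λ _ → 0ℤ)
Δ^-zero-suc k f v x = cong₂ _-_ (v x) (v (suc x))

Δ^-zero-mono : ∀ {j k} f → j ≤′ k → Δ^ j f ≗ (λ _ → 0ℤ) → Δ^ k f ≗ (λ _ → 0ℤ)
Δ^-zero-mono f ℕ.≤′-refl        v = v
Δ^-zero-mono f (ℕ.≤′-step {n} j≤′k) v = Δ^-zero-suc n f (Δ^-zero-mono f j≤′k v)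

Δ^-zero-*-id : ∀ k g → Δ^ k g ≗ (λ _ → 0ℤ) → Δ^ (suc k) (λ y → + y * g y) ≗ (λ _ → 0ℤ)
Δ^-zero-*-id k g v x rewrite Δ^-leibniz k g x | Δ^-zero-suc k g v x | v (suc x) =
  vanish (+ x) (+ suc k)
  where
  vanish : ∀ a b → a * 0ℤ - b * 0ℤ ≡ 0ℤ
  vanish = solve-∀

Δ^-zero-pow : ∀ r → Δ^ (suc r) (λ y → + (y ℕ.^ r)) ≗ (λ _ → 0ℤ)
Δ^-zero-pow zero    x = refl
Δ^-zero-pow (suc r) x = trans (Δ^-cong (suc (suc r)) (λ y → ℤ.pos-* y (y ℕ.^ r)) x)
                              (Δ^-zero-*-id (suc r) (λ y → + (y ℕ.^ r)) (Δ^-zero-pow r) x)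

𝟙[_<_] : ℤ → ℤ → ℕ
𝟙[ x < y ] = if does (x ℤ.<? y) then 1 else 0

neg1^-+ : ∀ m n → neg1^ (m ℕ.+ n) ≡ neg1^ m * neg1^ n
neg1^-+ zero    n = sym (ℤ.*-identityˡ _)
neg1^-+ (suc m) n = trans (cong -_ (neg1^-+ m n)) (ℤ.neg-distribˡ-* (neg1^ m) (neg1^ n))

filterᵇ-map : {A B : Set} (p : B → Bool) (g : A → B) (xs : List A) →
  filterᵇ p (map g xs) ≡ map g (filterᵇ (p ∘ g) xs)
filterᵇ-map p g []       = refl
filterᵇ-map p g (x ∷ xs) with p (g x)
... | true  = cong (g x ∷_) (filterᵇ-map p g xs)
... | false = filterᵇ-map p g xs

≢⇒T-not-≡ᵇ : ∀ {m n} → m ≢ n → T (not (m ℕ.≡ᵇ n))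
≢⇒T-not-≡ᵇ {m} {n} m≢n rewrite dec-false (m ℕ.≟ n) m≢n = tt

T-not-≡ᵇ⇒≢ : ∀ {m n} → T (not (m ℕ.≡ᵇ n)) → m ≢ n
T-not-≡ᵇ⇒≢ {m} t refl = subst T (Equivalence.to T-not-≡ t) (ℕ.≡⇒≡ᵇ m m refl)

-- A list ps of naturals stands for the set of absolute values {p + 1 : p ∈ ps}, as in letters.
signedLetters : List ℕ → List ℤ
signedLetters ps = map (λ p → + suc p) ps ++ map -[1+_] ps

wordWeight : (ℕ → ℤ) → List ℤ → ℤ
wordWeight χ []       = 1ℤ
wordWeight χ (y ∷ ys) = χ ∣ y ∣ * wordWeight χ ys

valueWeight : (ℕ → ℤ) → List ℕ → ℤ
valueWeight χ []       = 1ℤ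
valueWeight χ (p ∷ ps) = χ (suc p) * valueWeight χ ps

signedTerm : (ℕ → ℤ) → ℤ → (ℕ → ℤ) → List ℤ → ℤ
signedTerm χ prev f w =
  if distinctAbsᵇ w then wordWeight χ w * sgnB w * f (desFrom prev w) else 0ℤ

-- Placing a in front of a word creates an inversion with each later letter of smaller absolute
-- value; flipping the weight of those values records these sign changes.
flipBelow : (ℕ → ℤ) → ℤ → ℕ → ℤ
flipBelow χ a v = χ v * (if does (v ℕ.<? ∣ a ∣) then -1ℤ else 1ℤ)

letterSign : (ℕ → ℤ) → ℤ → ℤ
letterSign χ a = χ ∣ a ∣ * neg1^ 𝟙[ a < 0ℤ ]

without : ℤ → List ℕ → List ℕ
without a = filterᵇ (λ i → not (∣ a ∣ ℕ.≡ᵇ suc i))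

smallerAbs : ℤ → List ℤ → ℕ
smallerAbs a ws = length (filterᵇ (λ y → does (∣ y ∣ ℕ.<? ∣ a ∣)) ws)

wordWeight-flipBelow : ∀ χ a ws → wordWeight (flipBelow χ a) ws ≡ neg1^ (smallerAbs a ws) * wordWeight χ ws
wordWeight-flipBelow χ a []       = refl
wordWeight-flipBelow χ a (y ∷ ys) with does (∣ y ∣ ℕ.<? ∣ a ∣)
... | true  = trans (cong (χ ∣ y ∣ * -1ℤ *_) (wordWeight-flipBelow χ a ys))
                    (flip (χ ∣ y ∣) (neg1^ (smallerAbs a ys)) (wordWeight χ ys))
  where
  flip : ∀ x s w → x * -1ℤ * (s * w) ≡ - s * (x * w)
  flip = solve-∀
... | false = trans (cong (χ ∣ y ∣ * 1ℤ *_) (wordWeight-flipBelow χ a ys))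
                    (keep (χ ∣ y ∣) (neg1^ (smallerAbs a ys)) (wordWeight χ ys))
  where
  keep : ∀ x s w → x * 1ℤ * (s * w) ≡ s * (x * w)
  keep = solve-∀

signedTerm-∷ : ∀ χ prev f a ws →
  signedTerm χ prev f (a ∷ ws) ≡
  (if allᵇ (λ y → not (∣ a ∣ ℕ.≡ᵇ ∣ y ∣)) ws
   then letterSign χ a * signedTerm (flipBelow χ a) a (f ∘ (𝟙[ a < prev ] ℕ.+_)) ws
   else 0ℤ)
signedTerm-∷ χ prev f a ws with allᵇ (λ y → not (∣ a ∣ ℕ.≡ᵇ ∣ y ∣)) ws | distinctAbsᵇ ws
... | false | _     = refl
... | true  | false = sym (ℤ.*-zeroʳ (letterSign χ a))
... | true  | true  = begin
    χ ∣ a ∣ * wordWeight χ ws * (neg1^ (𝟙[ a < 0ℤ ] ℕ.+ negs ws) * neg1^ (smallerAbs a ws ℕ.+ invAbs ws)) * F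
  ≡⟨ cong (λ t → χ ∣ a ∣ * wordWeight χ ws * t * F)
       (cong₂ _*_ (neg1^-+ 𝟙[ a < 0ℤ ] (negs ws)) (neg1^-+ (smallerAbs a ws) (invAbs ws))) ⟩
    χ ∣ a ∣ * wordWeight χ ws
      * (neg1^ 𝟙[ a < 0ℤ ] * neg1^ (negs ws) * (neg1^ (smallerAbs a ws) * neg1^ (invAbs ws))) * F
  ≡⟨ regroup (χ ∣ a ∣) (wordWeight χ ws) (neg1^ 𝟙[ a < 0ℤ ]) (neg1^ (negs ws))
              (neg1^ (smallerAbs a ws)) (neg1^ (invAbs ws)) F ⟩
    letterSign χ a * (neg1^ (smallerAbs a ws) * wordWeight χ ws * sgnB ws * F)
  ≡⟨ cong (λ t → letterSign χ a * (t * sgnB ws * F)) (wordWeight-flipBelow χ a ws) ⟨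
    letterSign χ a * (wordWeight (flipBelow χ a) ws * sgnB ws * F) ∎
  where
  open ≡-Reasoning
  F : ℤ
  F = f (𝟙[ a < prev ] ℕ.+ desFrom a ws)
  regroup : ∀ x w p q r s t → x * w * (p * q * (r * s)) * t ≡ (x * p) * (r * w * (q * s) * t)
  regroup = solve-∀

signedLetters-without : ∀ a ps →
  filterᵇ (λ y → not (∣ a ∣ ℕ.≡ᵇ ∣ y ∣)) (signedLetters ps) ≡ signedLetters (without a ps)
signedLetters-without a ps = begin
    filterᵇ q (map (λ p → + suc p) ps ++ map -[1+_] ps)
  ≡⟨ List.filter-++ (T? ∘ q) (map (λ p → + suc p) ps) (map -[1+_] ps) ⟩
    filterᵇ q (map (λ p → + suc p) ps) ++ filterᵇ q (map -[1+_] ps)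
  ≡⟨ cong₂ _++_ (filterᵇ-map q (λ p → + suc p) ps) (filterᵇ-map q -[1+_] ps) ⟩
    signedLetters (without a ps) ∎
  where
  open ≡-Reasoning
  q : ℤ → Bool
  q y = not (∣ a ∣ ℕ.≡ᵇ ∣ y ∣)

∑-signedLetters : ∀ ps (h : ℤ → ℤ) → ∑ (signedLetters ps) h ≡ ∑ ps (λ p → h (+ suc p) + h -[1+ p ])
∑-signedLetters ps h = begin
    ∑ (map (λ p → + suc p) ps ++ map -[1+_] ps) h
  ≡⟨ ∑-++ (map (λ p → + suc p) ps) (map -[1+_] ps) h ⟩
    ∑ (map (λ p → + suc p) ps) h + ∑ (map -[1+_] ps) h
  ≡⟨ cong₂ _+_ (∑-map (λ p → + suc p) ps h) (∑-map -[1+_] ps h) ⟩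
    ∑ ps (λ p → h (+ suc p)) + ∑ ps (λ p → h -[1+ p ])
  ≡⟨ ∑-+ ps (λ p → h (+ suc p)) (λ p → h -[1+ p ]) ⟨
    ∑ ps (λ p → h (+ suc p) + h -[1+ p ]) ∎
  where open ≡-Reasoning

∑-signedTerm-∷ : ∀ k ps χ prev f a →
  ∑ (words k (signedLetters ps)) (signedTerm χ prev f ∘ (a ∷_))
  ≡ letterSign χ a * ∑ (words k (signedLetters (without a ps)))
                       (signedTerm (flipBelow χ a) a (f ∘ (𝟙[ a < prev ] ℕ.+_)))
∑-signedTerm-∷ k ps χ prev f a = begin
    ∑ (words k (signedLetters ps)) (signedTerm χ prev f ∘ (a ∷_))
  ≡⟨ ∑-cong (words k (signedLetters ps)) (signedTerm-∷ χ prev f a) ⟩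
    ∑ (words k (signedLetters ps)) (λ ws → if allᵇ q ws then letterSign χ a * g ws else 0ℤ)
  ≡⟨ ∑-words-allᵇ k (signedLetters ps) q (λ ws → letterSign χ a * g ws) ⟩
    ∑ (words k (filterᵇ q (signedLetters ps))) (λ ws → letterSign χ a * g ws)
  ≡⟨ cong (λ A → ∑ (words k A) (λ ws → letterSign χ a * g ws)) (signedLetters-without a ps) ⟩
    ∑ (words k (signedLetters (without a ps))) (λ ws → letterSign χ a * g ws)
  ≡⟨ ∑-*ˡ (words k (signedLetters (without a ps))) (letterSign χ a) g ⟩
    letterSign χ a * ∑ (words k (signedLetters (without a ps))) g ∎
  where
  open ≡-Reasoning
  q : ℤ → Bool
  q y = not (∣ a ∣ ℕ.≡ᵇ ∣ y ∣)
  g : List ℤ → ℤ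
  g = signedTerm (flipBelow χ a) a (f ∘ (𝟙[ a < prev ] ℕ.+_))

-- For the least available absolute value m: −m < prev ≤ m, i.e. after prev the letter −m is a
-- descent and +m is not.
straddlesᵇ : ℤ → List ℕ → Bool
straddlesᵇ prev []      = true
straddlesᵇ prev (μ ∷ _) = does (-[1+ μ ] ℤ.<? prev) ∧ not (does (+ suc μ ℤ.<? prev))

straddlesᵇ-+ : ∀ {μ p} qs → μ < p → straddlesᵇ (+ suc p) (μ ∷ qs) ≡ false
straddlesᵇ-+ {μ} {p} qs μ<p rewrite dec-true (+ suc μ ℤ.<? + suc p) (ℤ.+<+ (ℕ.s≤s μ<p)) = refl

straddlesᵇ-- : ∀ {μ p} qs → μ < p → straddlesᵇ -[1+ p ] (μ ∷ qs) ≡ false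
straddlesᵇ-- {μ} {p} qs μ<p rewrite dec-false (-[1+ μ ] ℤ.<? -[1+ p ]) (ℕ.<-asym μ<p ∘ ℤ.drop‿-<-) = refl

straddlesᵇ-+-min : ∀ {μ} qs → All (μ <_) qs → straddlesᵇ (+ suc μ) qs ≡ true
straddlesᵇ-+-min []      _           = refl
straddlesᵇ-+-min (ν ∷ _) (μ<ν ∷ _)
  rewrite dec-false (+ suc ν ℤ.<? + suc _) (ℕ.<-asym μ<ν ∘ ℕ.≤-pred ∘ ℤ.drop‿+<+) = refl

straddlesᵇ---min : ∀ {μ} qs → All (μ <_) qs → straddlesᵇ -[1+ μ ] qs ≡ true
straddlesᵇ---min []      _           = refl
straddlesᵇ---min (ν ∷ _) (μ<ν ∷ _) rewrite dec-true (-[1+ ν ] ℤ.<? -[1+ _ ]) (ℤ.-<- μ<ν) = refl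

without-min : ∀ {μ} rest → All (μ <_) rest → without (+ suc μ) (μ ∷ rest) ≡ rest
without-min {μ} rest μ<rest =
  trans (List.filter-reject (T? ∘ q) (λ t → T-not-≡ᵇ⇒≢ {μ} t refl))
        (List.filter-all (T? ∘ q) (All.map (λ μ<i → ≢⇒T-not-≡ᵇ (ℕ.<⇒≢ μ<i)) μ<rest))
  where
  q : ℕ → Bool
  q i = not (μ ℕ.≡ᵇ i)

without-larger : ∀ {μ p} rest → μ < p → without (+ suc p) (μ ∷ rest) ≡ μ ∷ without (+ suc p) rest
without-larger {μ} {p} rest μ<p =
  List.filter-accept (T? ∘ (λ i → not (p ℕ.≡ᵇ i))) (≢⇒T-not-≡ᵇ (ℕ.>⇒≢ μ<p))

length-without : ∀ {p ps} → AllPairs _<_ ps → p ∈ ps → suc (length (without (+ suc p) ps)) ≡ length ps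
length-without (p<rest ∷ _)      (here refl)     = cong (suc ∘ length) (without-min _ p<rest)
length-without (μ<rest ∷ sorted) (there p∈rest) =
  trans (cong (suc ∘ length) (without-larger _ (All.lookup μ<rest p∈rest)))
        (cong suc (length-without sorted p∈rest))

valueWeight-flipBelow-min : ∀ χ {μ} rest → All (μ <_) rest →
  valueWeight (flipBelow χ (+ suc μ)) rest ≡ valueWeight χ rest
valueWeight-flipBelow-min χ []      []          = refl
valueWeight-flipBelow-min χ {μ} (ν ∷ rest) (μ<ν ∷ μ<rest) =
  cong₂ _*_ unflipped (valueWeight-flipBelow-min χ rest μ<rest)
  where
  unflipped : flipBelow χ (+ suc μ) (suc ν) ≡ χ (suc ν)
  unflipped rewrite dec-false (suc ν ℕ.<? suc μ) (ℕ.<-asym μ<ν ∘ ℕ.≤-pred) = ℤ.*-identityʳ (χ (suc ν))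

SignedSumFormula : ℕ → Set
SignedSumFormula k = ∀ ps → AllPairs _<_ ps → length ps ≡ k → ∀ χ prev f →
  ∑ (words k (signedLetters ps)) (signedTerm χ prev f)
  ≡ valueWeight χ ps * (if straddlesᵇ prev ps then Δ^ k f 0 else 0ℤ)

∑-firstLetter : ∀ {k} → SignedSumFormula k → ∀ {ps} → AllPairs _<_ ps → ∀ χ prev f a →
  length (without a ps) ≡ k →
  ∑ (words k (signedLetters ps)) (signedTerm χ prev f ∘ (a ∷_))
  ≡ letterSign χ a * (valueWeight (flipBelow χ a) (without a ps)
      * (if straddlesᵇ a (without a ps) then Δ^ k (f ∘ (𝟙[ a < prev ] ℕ.+_)) 0 else 0ℤ))
∑-firstLetter {k} ih {ps} sorted χ prev f a len =
  trans (∑-signedTerm-∷ k ps χ prev f a)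
        (cong (letterSign χ a *_)
              (ih (without a ps) (AllPairs.filter⁺ _ sorted) len (flipBelow χ a) a (f ∘ (𝟙[ a < prev ] ℕ.+_))))

leastLetters-Δ : ∀ k μ qs W prev (f : ℕ → ℤ) (χ : ℕ → ℤ) →
  letterSign χ (+ suc μ) * (W * Δ^ k (f ∘ (𝟙[ + suc μ < prev ] ℕ.+_)) 0)
  + letterSign χ -[1+ μ ] * (W * Δ^ k (f ∘ (𝟙[ -[1+ μ ] < prev ] ℕ.+_)) 0)
  ≡ χ (suc μ) * W * (if straddlesᵇ prev (μ ∷ qs) then Δ^ (suc k) f 0 else 0ℤ)
leastLetters-Δ k μ qs W prev f χ with + suc μ ℤ.<? prev | -[1+ μ ] ℤ.<? prev
... | no _    | yes _ = trans (cong (λ B → c * 1ℤ * (W * Δ^ k f 0) + c * -1ℤ * (W * B)) (Δ^-shift k f 0))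
                               (differ c W (Δ^ k f 0) (Δ^ k f 1))
  where
  c : ℤ
  c = χ (suc μ)
  differ : ∀ c W A B → c * 1ℤ * (W * A) + c * -1ℤ * (W * B) ≡ c * W * (A - B)
  differ = solve-∀
... | no _    | no _  = cancel (χ (suc μ)) W (Δ^ k f 0)
  where
  cancel : ∀ c W A → c * 1ℤ * (W * A) + c * -1ℤ * (W * A) ≡ c * W * 0ℤ
  cancel = solve-∀
... | yes _   | yes _ = cancel (χ (suc μ)) W (Δ^ k (f ∘ suc) 0)
  where
  cancel : ∀ c W A → c * 1ℤ * (W * A) + c * -1ℤ * (W * A) ≡ c * W * 0ℤ
  cancel = solve-∀
... | yes μ<p | no ¬μ<p = ⊥-elim (¬μ<p (ℤ.<-trans ℤ.-<+ μ<p))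

∑-firstLetter-least : ∀ {k} → SignedSumFormula k → ∀ {μ rest} → AllPairs _<_ (μ ∷ rest) → length rest ≡ k →
  ∀ χ prev f a → without a (μ ∷ rest) ≡ rest → valueWeight (flipBelow χ a) rest ≡ valueWeight χ rest →
  straddlesᵇ a rest ≡ true →
  ∑ (words k (signedLetters (μ ∷ rest))) (signedTerm χ prev f ∘ (a ∷_))
  ≡ letterSign χ a * (valueWeight χ rest * Δ^ k (f ∘ (𝟙[ a < prev ] ℕ.+_)) 0)
∑-firstLetter-least {k} ih {μ} {rest} sorted len χ prev f a removed unflipped straddles = begin
    ∑ (words k (signedLetters (μ ∷ rest))) (signedTerm χ prev f ∘ (a ∷_))
  ≡⟨ ∑-firstLetter ih sorted χ prev f a (trans (cong length removed) len) ⟩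
    letterSign χ a * (valueWeight (flipBelow χ a) (without a (μ ∷ rest))
      * (if straddlesᵇ a (without a (μ ∷ rest)) then D else 0ℤ))
  ≡⟨ cong (λ qs → letterSign χ a * (valueWeight (flipBelow χ a) qs * (if straddlesᵇ a qs then D else 0ℤ))) removed ⟩
    letterSign χ a * (valueWeight (flipBelow χ a) rest * (if straddlesᵇ a rest then D else 0ℤ))
  ≡⟨ cong₂ (λ w b → letterSign χ a * (w * (if b then D else 0ℤ))) unflipped straddles ⟩
    letterSign χ a * (valueWeight χ rest * D) ∎
  where
  open ≡-Reasoning
  D : ℤ
  D = Δ^ k (f ∘ (𝟙[ a < prev ] ℕ.+_)) 0

∑-firstLetter-outside : ∀ {k} → SignedSumFormula k → ∀ {ps} → AllPairs _<_ ps → ∀ χ prev f a →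
  length (without a ps) ≡ k → straddlesᵇ a (without a ps) ≡ false →
  ∑ (words k (signedLetters ps)) (signedTerm χ prev f ∘ (a ∷_)) ≡ 0ℤ
∑-firstLetter-outside {k} ih {ps} sorted χ prev f a len outside = begin
    ∑ (words k (signedLetters ps)) (signedTerm χ prev f ∘ (a ∷_))
  ≡⟨ ∑-firstLetter ih sorted χ prev f a len ⟩
    letterSign χ a * (W * (if straddlesᵇ a (without a ps) then Δ^ k (f ∘ (𝟙[ a < prev ] ℕ.+_)) 0 else 0ℤ))
  ≡⟨ cong (λ b → letterSign χ a * (W * (if b then Δ^ k (f ∘ (𝟙[ a < prev ] ℕ.+_)) 0 else 0ℤ))) outside ⟩
    letterSign χ a * (W * 0ℤ)
  ≡⟨ cong (letterSign χ a *_) (ℤ.*-zeroʳ W) ⟩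
    letterSign χ a * 0ℤ
  ≡⟨ ℤ.*-zeroʳ (letterSign χ a) ⟩
    0ℤ ∎
  where
  open ≡-Reasoning
  W : ℤ
  W = valueWeight (flipBelow χ a) (without a ps)

signedSumFormula-suc : ∀ {k} → SignedSumFormula k → SignedSumFormula (suc k)
signedSumFormula-suc {k} ih (μ ∷ rest) sorted@(μ<rest ∷ _) len χ prev f = begin
    ∑ (words (suc k) (signedLetters (μ ∷ rest))) (signedTerm χ prev f)
  ≡⟨ ∑-words-suc k (signedLetters (μ ∷ rest)) (signedTerm χ prev f) ⟩
    ∑ (signedLetters (μ ∷ rest)) X
  ≡⟨ ∑-signedLetters (μ ∷ rest) X ⟩
    (X (+ suc μ) + X -[1+ μ ]) + ∑ rest (λ p → X (+ suc p) + X -[1+ p ])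
  ≡⟨ cong (_+_ (X (+ suc μ) + X -[1+ μ ]))
          (∑-zero rest (λ p∈rest → cong₂ _+_ (larger-+ p∈rest) (larger-- p∈rest))) ⟩
    (X (+ suc μ) + X -[1+ μ ]) + 0ℤ
  ≡⟨ ℤ.+-identityʳ _ ⟩
    X (+ suc μ) + X -[1+ μ ]
  ≡⟨ cong₂ _+_ (least (+ suc μ) removed unflipped (straddlesᵇ-+-min rest μ<rest))
                (least -[1+ μ ] removed unflipped (straddlesᵇ---min rest μ<rest)) ⟩
    letterSign χ (+ suc μ) * (valueWeight χ rest * Δ^ k (f ∘ (𝟙[ + suc μ < prev ] ℕ.+_)) 0)
    + letterSign χ -[1+ μ ] * (valueWeight χ rest * Δ^ k (f ∘ (𝟙[ -[1+ μ ] < prev ] ℕ.+_)) 0)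
  ≡⟨ leastLetters-Δ k μ rest (valueWeight χ rest) prev f χ ⟩
    valueWeight χ (μ ∷ rest) * (if straddlesᵇ prev (μ ∷ rest) then Δ^ (suc k) f 0 else 0ℤ) ∎
  where
  open ≡-Reasoning
  X : ℤ → ℤ
  X a = ∑ (words k (signedLetters (μ ∷ rest))) (signedTerm χ prev f ∘ (a ∷_))
  least : ∀ a → without a (μ ∷ rest) ≡ rest → valueWeight (flipBelow χ a) rest ≡ valueWeight χ rest →
    straddlesᵇ a rest ≡ true → X a ≡ letterSign χ a * (valueWeight χ rest * Δ^ k (f ∘ (𝟙[ a < prev ] ℕ.+_)) 0)
  least = ∑-firstLetter-least ih sorted (ℕ.suc-injective len) χ prev f
  -- ±(μ + 1) have the same absolute value, so these two facts serve both letters.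
  removed : without (+ suc μ) (μ ∷ rest) ≡ rest
  removed = without-min rest μ<rest
  unflipped : valueWeight (flipBelow χ (+ suc μ)) rest ≡ valueWeight χ rest
  unflipped = valueWeight-flipBelow-min χ rest μ<rest
  larger-length : ∀ {p} → p ∈ rest → length (without (+ suc p) (μ ∷ rest)) ≡ k
  larger-length p∈rest = ℕ.suc-injective (trans (length-without sorted (there p∈rest)) len)
  larger-+ : ∀ {p} → p ∈ rest → X (+ suc p) ≡ 0ℤ
  larger-+ {p} p∈rest = ∑-firstLetter-outside ih sorted χ prev f (+ suc p) (larger-length p∈rest)
    (trans (cong (straddlesᵇ (+ suc p)) (without-larger rest (All.lookup μ<rest p∈rest)))
           (straddlesᵇ-+ (without (+ suc p) rest) (All.lookup μ<rest p∈rest)))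
  larger-- : ∀ {p} → p ∈ rest → X -[1+ p ] ≡ 0ℤ
  larger-- {p} p∈rest = ∑-firstLetter-outside ih sorted χ prev f -[1+ p ] (larger-length p∈rest)
    (trans (cong (straddlesᵇ -[1+ p ]) (without-larger rest (All.lookup μ<rest p∈rest)))
           (straddlesᵇ-- (without (+ suc p) rest) (All.lookup μ<rest p∈rest)))

signedSumFormula : ∀ k → SignedSumFormula k
signedSumFormula zero    [] _ _ χ prev f = unit (f 0)
  where
  unit : ∀ t → 1ℤ * (1ℤ * 1ℤ) * t + 0ℤ ≡ 1ℤ * t
  unit = solve-∀
signedSumFormula (suc k) = signedSumFormula-suc (signedSumFormula k)

wordWeight-1 : ∀ w → wordWeight (λ _ → 1ℤ) w ≡ 1ℤ
wordWeight-1 []       = refl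
wordWeight-1 (y ∷ ys) = trans (ℤ.*-identityˡ _) (wordWeight-1 ys)

valueWeight-1 : ∀ ps → valueWeight (λ _ → 1ℤ) ps ≡ 1ℤ
valueWeight-1 []       = refl
valueWeight-1 (p ∷ ps) = trans (ℤ.*-identityˡ _) (valueWeight-1 ps)

straddlesᵇ-0 : ∀ ps → straddlesᵇ 0ℤ ps ≡ true
straddlesᵇ-0 []      = refl
straddlesᵇ-0 (μ ∷ _) rewrite dec-false (+ suc μ ℤ.<? 0ℤ) (ℕ.n≮0 ∘ ℤ.drop‿+<+) = refl

∑-sgnB : ∀ n (f : ℕ → ℤ) → ∑ (B n) (λ w → sgnB w * f (desB w)) ≡ Δ^ n f 0
∑-sgnB n f = begin
    ∑ (B n) (λ w → sgnB w * f (desB w))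
  ≡⟨ ∑-filterᵇ distinctAbsᵇ (words n (letters n)) _ ⟩
    ∑ (words n (letters n)) (λ w → if distinctAbsᵇ w then sgnB w * f (desB w) else 0ℤ)
  ≡⟨ ∑-cong (words n (letters n)) unweighted ⟨
    ∑ (words n (signedLetters (upTo n))) (signedTerm (λ _ → 1ℤ) 0ℤ f)
  ≡⟨ signedSumFormula n (upTo n) (AllPairs.applyUpTo⁺₁ (λ i → i) n (λ i<j _ → i<j)) (List.length-upTo n)
                      (λ _ → 1ℤ) 0ℤ f ⟩
    valueWeight (λ _ → 1ℤ) (upTo n) * (if straddlesᵇ 0ℤ (upTo n) then Δ^ n f 0 else 0ℤ)
  ≡⟨ cong₂ (λ w b → w * (if b then Δ^ n f 0 else 0ℤ)) (valueWeight-1 (upTo n)) (straddlesᵇ-0 (upTo n)) ⟩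
    1ℤ * Δ^ n f 0
  ≡⟨ ℤ.*-identityˡ _ ⟩
    Δ^ n f 0 ∎
  where
  open ≡-Reasoning
  unweighted : ∀ w → signedTerm (λ _ → 1ℤ) 0ℤ f w ≡ (if distinctAbsᵇ w then sgnB w * f (desB w) else 0ℤ)
  unweighted w = cong (λ c → if distinctAbsᵇ w then c * f (desB w) else 0ℤ)
    (trans (cong (_* sgnB w) (wordWeight-1 w)) (ℤ.*-identityˡ (sgnB w)))

withSign : {A : Set} → (A → ℤ) → ℤ → List A → List A
withSign s c = filterᵇ (λ x → does (s x ℤ.≟ c))

module _ {A : Set} (s : A → ℤ) (s≡±1 : ∀ x → s x ≡ 1ℤ ⊎ s x ≡ -1ℤ) where

  ∑-split-±1 : ∀ xs h → ∑ xs h ≡ ∑ (withSign s 1ℤ xs) h + ∑ (withSign s -1ℤ xs) h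
  ∑-split-±1 []       h = refl
  ∑-split-±1 (x ∷ xs) h with s x | s≡±1 x
  ... | _ | inj₁ refl = trans (cong (_+_ (h x)) (∑-split-±1 xs h))
    (sym (ℤ.+-assoc (h x) (∑ (withSign s 1ℤ xs) h) (∑ (withSign s -1ℤ xs) h)))
  ... | _ | inj₂ refl = trans (cong (_+_ (h x)) (∑-split-±1 xs h))
    (swap (h x) (∑ (withSign s 1ℤ xs) h) (∑ (withSign s -1ℤ xs) h))
    where
    swap : ∀ a b c → a + (b + c) ≡ b + (a + c)
    swap = solve-∀

  ∑-signed-±1 : ∀ xs h → ∑ xs (λ x → s x * h x) ≡ ∑ (withSign s 1ℤ xs) h - ∑ (withSign s -1ℤ xs) h
  ∑-signed-±1 []       h = refl
  ∑-signed-±1 (x ∷ xs) h with s x | s≡±1 x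
  ... | _ | inj₁ refl = trans (cong (_+_ (1ℤ * h x)) (∑-signed-±1 xs h))
    (plus (h x) (∑ (withSign s 1ℤ xs) h) (∑ (withSign s -1ℤ xs) h))
    where
    plus : ∀ a b c → 1ℤ * a + (b - c) ≡ (a + b) - c
    plus = solve-∀
  ... | _ | inj₂ refl = trans (cong (_+_ (-1ℤ * h x)) (∑-signed-±1 xs h))
    (minus (h x) (∑ (withSign s 1ℤ xs) h) (∑ (withSign s -1ℤ xs) h))
    where
    minus : ∀ a b c → -1ℤ * a + (b - c) ≡ b - (a + c)
    minus = solve-∀

neg1^≡±1 : ∀ k → neg1^ k ≡ 1ℤ ⊎ neg1^ k ≡ -1ℤ
neg1^≡±1 zero    = inj₁ refl
neg1^≡±1 (suc k) with neg1^ k | neg1^≡±1 k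
... | _ | inj₁ refl = inj₂ refl
... | _ | inj₂ refl = inj₁ refl

sgnB≡±1 : ∀ w → sgnB w ≡ 1ℤ ⊎ sgnB w ≡ -1ℤ
sgnB≡±1 w = subst (λ t → t ≡ 1ℤ ⊎ t ≡ -1ℤ) (neg1^-+ (negs w) (invAbs w)) (neg1^≡±1 (negs w ℕ.+ invAbs w))

∑-pos : {A : Set} (xs : List A) (g : A → ℕ) → ∑ xs (λ x → + g x) ≡ + sum (map g xs)
∑-pos []       g = refl
∑-pos (x ∷ xs) g = trans (cong (_+_ (+ g x)) (∑-pos xs g)) (sym (ℤ.pos-+ (g x) (sum (map g xs))))

powerSum : ℕ → List (List ℤ) → ℕ
powerSum r S = sum (map (λ w → desB w ℕ.^ r) S)

powerSum-0 : ∀ S → powerSum 0 S ≡ length S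
powerSum-0 []      = refl
powerSum-0 (_ ∷ S) = cong suc (powerSum-0 S)

powerSum-B : ∀ r n → powerSum r (B n) ≡ powerSum r (Bplus n) ℕ.+ powerSum r (Bminus n)
powerSum-B r n = ℤ.+-injective (begin
    + powerSum r (B n)
  ≡⟨ ∑-pos (B n) g ⟨
    ∑ (B n) (λ w → + g w)
  ≡⟨ ∑-split-±1 sgnB sgnB≡±1 (B n) (λ w → + g w) ⟩
    ∑ (Bplus n) (λ w → + g w) + ∑ (Bminus n) (λ w → + g w)
  ≡⟨ cong₂ _+_ (∑-pos (Bplus n) g) (∑-pos (Bminus n) g) ⟩
    + powerSum r (Bplus n) + + powerSum r (Bminus n)
  ≡⟨ ℤ.pos-+ (powerSum r (Bplus n)) (powerSum r (Bminus n)) ⟨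
    + (powerSum r (Bplus n) ℕ.+ powerSum r (Bminus n)) ∎)
  where
  open ≡-Reasoning
  g : List ℤ → ℕ
  g w = desB w ℕ.^ r

powerSum-Bplus≡Bminus : ∀ {r n} → r < n → powerSum r (Bplus n) ≡ powerSum r (Bminus n)
powerSum-Bplus≡Bminus {r} {n} r<n = ℤ.+-injective (ℤ.i-j≡0⇒i≡j _ _ (begin
    + powerSum r (Bplus n) - + powerSum r (Bminus n)
  ≡⟨ cong₂ _-_ (∑-pos (Bplus n) g) (∑-pos (Bminus n) g) ⟨
    ∑ (Bplus n) (λ w → + g w) - ∑ (Bminus n) (λ w → + g w)
  ≡⟨ ∑-signed-±1 sgnB sgnB≡±1 (B n) (λ w → + g w) ⟨
    ∑ (B n) (λ w → sgnB w * + g w)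
  ≡⟨ ∑-sgnB n (λ d → + (d ℕ.^ r)) ⟩
    Δ^ n (λ d → + (d ℕ.^ r)) 0
  ≡⟨ Δ^-zero-mono _ (ℕ.≤⇒≤′ r<n) (Δ^-zero-pow r) 0 ⟩
    0ℤ ∎))
  where
  open ≡-Reasoning
  g : List ℤ → ℕ
  g w = desB w ℕ.^ r

average-scale : ∀ k .{{_ : ℕ.NonZero k}} (xs ys : List ℕ) →
  sum ys ≡ k ℕ.* sum xs → length ys ≡ k ℕ.* length xs → average xs ≡ average ys
average-scale k []       []       _  _  = refl
average-scale k []       (_ ∷ _)  _  ly = ⊥-elim (ℕ.1+n≢0 (trans ly (ℕ.*-zeroʳ k)))
average-scale k (_ ∷ xs) []       _  ly = ⊥-elim (ℕ.≢-nonZero⁻¹ (k ℕ.* suc (length xs)) {{ℕ.m*n≢0 k _}} (sym ly))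
average-scale k (x ∷ xs) (y ∷ ys) sy ly =
  ℚ.fromℚᵘ-cong {mkℚᵘ (+ sum (x ∷ xs)) (length xs)} {mkℚᵘ (+ sum (y ∷ ys)) (length ys)} (*≡* (begin
    + sum (x ∷ xs) * + length (y ∷ ys)
  ≡⟨ ℤ.pos-* (sum (x ∷ xs)) (length (y ∷ ys)) ⟨
    + (sum (x ∷ xs) ℕ.* length (y ∷ ys))
  ≡⟨ cong +_ (trans (cong (sum (x ∷ xs) ℕ.*_) ly)
       (trans (cross k (sum (x ∷ xs)) (length (x ∷ xs))) (cong (ℕ._* length (x ∷ xs)) (sym sy)))) ⟩
    + (sum (y ∷ ys) ℕ.* length (x ∷ xs))
  ≡⟨ ℤ.pos-* (sum (y ∷ ys)) (length (x ∷ xs)) ⟩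
    + sum (y ∷ ys) * + length (x ∷ xs) ∎))
  where
  open ≡-Reasoning
  cross : ∀ c s l → s ℕ.* (c ℕ.* l) ≡ c ℕ.* s ℕ.* l
  cross = ℕ-Solver.solve-∀

powerSum-B-double : ∀ {r n} → r < n →
  powerSum r (B n) ≡ 2 ℕ.* powerSum r (Bplus n) × powerSum r (B n) ≡ 2 ℕ.* powerSum r (Bminus n)
powerSum-B-double {r} {n} r<n =
    trans (powerSum-B r n) (trans (cong (P ℕ.+_) (sym balanced)) (double P))
  , trans (powerSum-B r n) (trans (cong (ℕ._+ M) balanced) (double M))
  where
  P M : ℕ
  P = powerSum r (Bplus n)
  M = powerSum r (Bminus n)
  balanced : P ≡ M
  balanced = powerSum-Bplus≡Bminus r<n
  double : ∀ a → a ℕ.+ a ≡ 2 ℕ.* a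
  double = ℕ-Solver.solve-∀

momentDesB-half : ∀ r n S → (∀ {j} → j < n → powerSum j (B n) ≡ 2 ℕ.* powerSum j S) →
  r < n → momentDesB r S ≡ momentDesB r (B n)
momentDesB-half r n S double r<n = average-scale 2 (map g S) (map g (B n)) (double r<n) (begin
    length (map g (B n))       ≡⟨ List.length-map g (B n) ⟩
    length (B n)               ≡⟨ powerSum-0 (B n) ⟨
    powerSum 0 (B n)           ≡⟨ double (ℕ.≤-<-trans ℕ.z≤n r<n) ⟩
    2 ℕ.* powerSum 0 S         ≡⟨ cong (2 ℕ.*_) (trans (powerSum-0 S) (sym (List.length-map g S))) ⟩
    2 ℕ.* length (map g S)     ∎)
  where
  open ≡-Reasoning
  g : List ℤ → ℕ
  g w = desB w ℕ.^ r

proposition5p7 : (r n : ℕ) → 1 ≤ r → r < n →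
    (momentDesB r (Bplus n) ≡ momentDesB r (B n)) × (momentDesB r (Bminus n) ≡ momentDesB r (B n))
proposition5p7 r n _ r<n =
    momentDesB-half r n (Bplus n) (proj₁ ∘ powerSum-B-double) r<n
  , momentDesB-half r n (Bminus n) (proj₂ ∘ powerSum-B-double) r<n
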